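{- Let $k>1$ be odd and let $G=D_{k^2+1}$ be the dihedral group of order $n=k^2+1$, generated by $s,r$ with $s^2=1$, $r^{n/2}=1$, $sr=r^{ -1}s$. Let $A_1=\{r^i: 0\le i\le \tfrac{k-1}{2}\}\cup\{sr^j: 0\le j\le\tfrac{k-3}{2}\}$ and $A_2=\{r^{ik}: 1\le i\le\tfrac{k-1}{2}\}\cup\{sr^{jk+\frac{k-1}{2}}: 0\le j\le\tfrac{k-1}{2}\}$. Then $\{A_1,A_2\}$ is a $(k^2+1,2,k,1)$-SEDF in $G$. In particular, a $(k^2+1,2,k,1)$-SEDF exists in $D_{k^2+1}$.
   Context: Let $G$ be a group of order $n$ (written multiplicatively). An $(n,m,k,\lambda)$-SEDF in $G$ is a set of $m\ge2$ pairwise disjoint $k$-subsets $A_1,\ldots,A_m$ of $G$ such that for every $i$ the multiset $\{xy^{ -1}: x\in A_i, y\in \bigcup_{j\neq i}A_j\}$ contains every non-identity element of $G$ exactly $\lambda$ times. $D_n$ denotes the dihedral group of order $n$, $D_n=\{s^ir^j: 0\le i\le1, 0\le j<n/2\}$. -}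

module Defs where

open import Data.Bool using (Bool; true; false; _xor_; if_then_else_)
open import Data.Bool.Properties using () renaming (_≟_ to _≟ᵇ_)
open import Data.Nat using (ℕ; zero; suc; _+_; _*_; _∸_; _≤_; NonZero)
open import Data.Nat.DivMod using (_mod_)
open import Data.Fin using (Fin; toℕ) renaming (zero to fzero; suc to fsuc)
open import Data.Fin.Properties using () renaming (_≟_ to _≟ᶠ_)
open import Data.Product using (_×_; _,_)
open import Data.Product.Properties using (≡-dec)
open import Data.List using (List; length; map; filter; concatMap; allFin; upTo)
open import Data.List.Membership.Propositional using (_∈_; _∉_)
open import Data.List.Relation.Unary.Unique.Propositional using (Unique)
open import Relation.Binary.PropositionalEquality using (_≡_; _≢_)
open import Relation.Binary.Definitions using (DecidableEquality)
open import Relation.Nullary using (¬?)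

-- The dihedral group of order 2m, D_{2m} = { s^a r^j : a ∈ {0,1}, 0 ≤ j < m },
-- with s^2 = 1, r^m = 1, s r = r^{-1} s.
-- An element s^a r^j is represented as (a , j) with a : Bool (true = s^1).

Dih : ℕ → Set
Dih m = Bool × Fin m

module Dihedral (m : ℕ) .{{_ : NonZero m}} where

  _≟D_ : DecidableEquality (Dih m)
  _≟D_ = ≡-dec _≟ᵇ_ _≟ᶠ_

  r^ : ℕ → Dih m
  r^ i = false , (i mod m)

  sr^ : ℕ → Dih m
  sr^ j = true , (j mod m)

  e : Dih m
  e = r^ 0

  -- (s^a r^i)(s^b r^j) = s^(a+b) r^((-1)^b i + j)
  _·_ : Dih m → Dih m → Dih m
  (a , i) · (b , j) =
    (a xor b) , (((if b then m ∸ toℕ i else toℕ i) + toℕ j) mod m)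

  inv : Dih m → Dih m
  inv (false , i) = false , ((m ∸ toℕ i) mod m)
  inv (true  , i) = true , i

  mult : Dih m → List (Dih m) → ℕ
  mult g xs = length (filter (_≟D g) xs)

  quotients : List (Dih m) → List (Dih m) → List (Dih m)
  quotients X Y = concatMap (λ x → map (λ y → x · inv y) Y) X

  -- (2m, t, k, λ)-SEDF in D_{2m}: a family A_0, …, A_{t-1} of k-subsets
  -- (duplicate-free lists of length k), t ≥ 2, pairwise disjoint, such that
  -- for each i the multiset { x y^{-1} : x ∈ A_i, y ∈ ⋃_{j≠i} A_j }
  -- contains every non-identity element exactly λ times.
  IsSEDF : (t k λ′ : ℕ) → (Fin t → List (Dih m)) → Set
  IsSEDF t k λ′ A =
    (2 ≤ t)
    × (∀ i → Unique (A i) × length (A i) ≡ k)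
    × (∀ i j → i ≢ j → ∀ x → x ∈ A i → x ∉ A j)
    × (∀ i g → g ≢ e →
         mult g (quotients (A i) (concatMap A (filter (λ j → ¬? (j ≟ᶠ i)) (allFin t))))
           ≡ λ′)

range : ℕ → ℕ → List ℕ
range a b = map (a +_) (upTo (suc b ∸ a))

module Thm62Sets (k m : ℕ) .{{_ : NonZero m}} where
  open Dihedral m
  open import Data.Nat using (_/_)
  open import Data.List using (_++_)

  A₁ : List (Dih m)
  A₁ = map r^ (range 0 ((k ∸ 1) / 2)) ++ map sr^ (range 0 ((k ∸ 3) / 2))

  A₂ : List (Dih m)
  A₂ = map (λ i → r^ (i * k)) (range 1 ((k ∸ 1) / 2))
       ++ map (λ j → sr^ (j * k + (k ∸ 1) / 2)) (range 0 ((k ∸ 1) / 2))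

  family : Fin 2 → List (Dih m)
  family fzero = A₁
  family (fsuc _) = A₂

-- Write k = 2h + 1, so that the rotation subgroup ⟨r⟩ has order m = (k² + 1)/2 = 1 + h + hk.
-- As |A₁| |A₂| = k² = |G| − 1, it suffices that every non-identity element is a quotient x y⁻¹
-- with x ∈ A₁, y ∈ A₂: then each occurs exactly once, and the quotients y x⁻¹ are their inverses.
-- Dividing by k, write c + qk with 0 ≤ c < k; then
--   r^(c+qk+1) = sr^(h−1−c) (sr^(qk+h))⁻¹  if c < h,  and  r^(c−h) (r^((h−q)k))⁻¹  otherwise,
--   sr^(c+qk)  = r^(h−c) (sr^(qk+h))⁻¹     if c ≤ h,  and  sr^(c−h−1) (r^((h−q)k))⁻¹  otherwise,
-- the second cases because (h + 1) + hk = m.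

module Submission where

open import Defs
open import Data.Bool using (Bool; true; false; not)
open import Data.Bool.Properties using (xor-identityʳ; xor-comm)
open import Data.Fin using (Fin; toℕ) renaming (zero to fzero; suc to fsuc)
open import Data.Fin.Properties using (toℕ-fromℕ<; toℕ-injective; toℕ<n; toℕ≤n)
  renaming (suc-injective to fsuc-injective)
open import Data.List using (List; []; _∷_; length; filter; map; _++_; upTo; allFin; cartesianProductWith)
open import Data.List.Membership.Propositional using (_∈_; _∉_)
open import Data.List.Membership.Propositional.Properties
open import Data.List.Properties using (length-++; length-map; length-upTo; length-tabulate; ++-identityʳ)
open import Data.List.Relation.Binary.Disjoint.Propositional using (Disjoint)
open import Data.List.Relation.Unary.All as All using (All; []; _∷_)
import Data.List.Relation.Unary.All.Properties as All
open import Data.List.Relation.Unary.AllPairs using ([]; _∷_)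
open import Data.List.Relation.Unary.Any using (here; there)
open import Data.List.Relation.Unary.Unique.Propositional using (Unique)
import Data.List.Relation.Unary.Unique.Propositional.Properties as Unique
open import Data.Nat using (ℕ; zero; suc; _+_; _*_; _∸_; _/_; _%_; _≤_; _<_; z≤n; s≤s; s≤s⁻¹; _≤?_; _<?_)
open import Data.Nat using (NonZero; >-nonZero⁻¹)
open import Data.Nat.DivMod
open import Data.Nat.ListAction using (sum)
open import Data.Nat.Properties
open import Algebra.Properties.CommutativeSemigroup +-commutativeSemigroup
  using (x∙yz≈zx∙y; x∙yz≈yx∙z; xy∙z≈xz∙y; xy∙z≈y∙xz)
open import Data.Nat.Tactic.RingSolver using (solve-∀)
open import Data.Product using (_×_; _,_; proj₁; proj₂; Σ; ∃; ∃₂)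
open import Data.Sum using (inj₁; inj₂)
open import Function using (_∘_; _∘′_; _∋_)
open import Relation.Binary.Definitions using (DecidableEquality)
open import Relation.Binary.PropositionalEquality
open import Relation.Nullary using (yes; no)
open import Relation.Nullary.Negation using (contradiction)


module _ {A : Set} {f : A → ℕ} where

  length≤sum : ∀ {xs} → All (λ x → 1 ≤ f x) xs → length xs ≤ sum (map f xs)
  length≤sum []       = z≤n
  length≤sum (p ∷ ps) = +-mono-≤ p (length≤sum ps)

  ∈⇒f+length≤1+sum : ∀ {x xs} → All (λ x → 1 ≤ f x) xs → x ∈ xs →
                      f x + length xs ≤ suc (sum (map f xs))
  ∈⇒f+length≤1+sum {x} {y ∷ ys} (_ ∷ ps) (here refl) = begin
    f x + suc (length ys)  ≡⟨ +-suc (f x) (length ys) ⟩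
    suc (f x + length ys)  ≤⟨ s≤s (+-monoʳ-≤ (f x) (length≤sum ps)) ⟩
    suc (f x + sum (map f ys)) ∎
    where open ≤-Reasoning
  ∈⇒f+length≤1+sum {x} {y ∷ ys} (p ∷ ps) (there x∈) = begin
    f x + suc (length ys)      ≡⟨ +-suc (f x) (length ys) ⟩
    suc (f x + length ys)      ≤⟨ s≤s (∈⇒f+length≤1+sum ps x∈) ⟩
    suc (suc (sum (map f ys))) ≤⟨ s≤s (+-monoˡ-≤ (sum (map f ys)) p) ⟩
    suc (f y + sum (map f ys)) ∎
    where open ≤-Reasoning

module Counting {A : Set} (_≟_ : DecidableEquality A) where

  count : A → List A → ℕ
  count g xs = length (filter (_≟ g) xs)

  ∑count : List A → List A → ℕ
  ∑count us xs = sum (map (λ u → count u xs) us)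

  ∈⇒1≤count : ∀ {g xs} → g ∈ xs → 1 ≤ count g xs
  ∈⇒1≤count g∈ = ∈-length (∈-filter⁺ (_≟ _) g∈ refl)

  ∑count-∷-fresh : ∀ x us xs → All (x ≢_) us → ∑count us (x ∷ xs) ≡ ∑count us xs
  ∑count-∷-fresh x []       xs []       = refl
  ∑count-∷-fresh x (u ∷ us) xs (p ∷ ps) with x ≟ u
  ... | yes x≡u = contradiction x≡u p
  ... | no  _   = cong (count u xs +_) (∑count-∷-fresh x us xs ps)

  ∑count-∷ : ∀ x {us} xs → Unique us → ∑count us (x ∷ xs) ≤ suc (∑count us xs)
  ∑count-∷ x {[]}     xs _ = z≤n
  ∑count-∷ x {u ∷ us} xs (x∉ ∷ !us) with x ≟ u
  ... | yes refl = ≤-reflexive (cong (suc ∘′ (count u xs +_)) (∑count-∷-fresh x us xs x∉))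
  ... | no  _    = begin
    count u xs + ∑count us (x ∷ xs) ≤⟨ +-monoʳ-≤ (count u xs) (∑count-∷ x xs !us) ⟩
    count u xs + suc (∑count us xs) ≡⟨ +-suc (count u xs) (∑count us xs) ⟩
    suc (∑count (u ∷ us) xs)        ∎
    where open ≤-Reasoning

  ∑count≤length : ∀ {us} xs → Unique us → ∑count us xs ≤ length xs
  ∑count≤length {us} []       _   = ≤-reflexive (zeros us)
    where
    zeros : ∀ us → ∑count us [] ≡ 0
    zeros []       = refl
    zeros (_ ∷ us) = zeros us
  ∑count≤length      (x ∷ xs) !us = ≤-trans (∑count-∷ x xs !us) (s≤s (∑count≤length xs !us))

  cover⇒count≡1 : ∀ {us xs} → Unique us → length xs ≤ length us →
                  (∀ {u} → u ∈ us → u ∈ xs) → ∀ {g} → g ∈ us → count g xs ≡ 1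
  cover⇒count≡1 {us} {xs} !us len cover {g} g∈ =
    ≤-antisym (+-cancelʳ-≤ (length us) (count g xs) 1 bound) (∈⇒1≤count (cover g∈))
    where
    bound : count g xs + length us ≤ 1 + length us
    bound = begin
      count g xs + length us ≤⟨ ∈⇒f+length≤1+sum (All.tabulate (∈⇒1≤count ∘ cover)) g∈ ⟩
      suc (∑count us xs)     ≤⟨ s≤s (≤-trans (∑count≤length xs !us) len) ⟩
      1 + length us          ∎
      where open ≤-Reasoning

map-injectiveOn⁺ : ∀ {A B : Set} (f : A → B) {xs} →
                   (∀ {x y} → x ∈ xs → y ∈ xs → f x ≡ f y → x ≡ y) → Unique xs → Unique (map f xs)
map-injectiveOn⁺ f                   _   []             = []
map-injectiveOn⁺ f {x ∷ xs} inj (x∉xs ∷ !xs) =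
  All.map⁺ (All.tabulate (λ y∈ fx≡fy → All.lookup x∉xs y∈ (inj (here refl) (there y∈) fx≡fy)))
  ∷ map-injectiveOn⁺ f (λ x∈ y∈ → inj (there x∈) (there y∈)) !xs

length-range : ∀ a b → length (range a b) ≡ suc b ∸ a
length-range a b = trans (length-map (a +_) (upTo (suc b ∸ a))) (length-upTo (suc b ∸ a))

range-unique : ∀ a b → Unique (range a b)
range-unique a b = Unique.map⁺ (+-cancelˡ-≡ a _ _) (Unique.upTo⁺ (suc b ∸ a))

∈-range⁺ : ∀ a {b d} → a + d ≤ b → a + d ∈ range a b
∈-range⁺ a {b} {d} a+d≤b =
  ∈-map⁺ (a +_) (∈-upTo⁺ (m+n≤o⇒m≤o∸n (suc d) (s≤s (subst (_≤ b) (+-comm a d) a+d≤b))))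

∈-range⁻ : ∀ a b {i} → i ∈ range a b → a ≤ i × i ≤ b
∈-range⁻ a b i∈ with d , d∈ , refl ← ∈-map⁻ (a +_) i∈ = m≤m+n a d , s≤s⁻¹ (begin-strict
  a + d           <⟨ +-monoʳ-< a d<n ⟩
  a + (suc b ∸ a) ≡⟨ m+[n∸m]≡n {a} (<⇒≤ a<1+b) ⟩
  suc b           ∎)
  where
  open ≤-Reasoning
  d<n = ∈-upTo⁻ d∈
  a<1+b : a < suc b
  a<1+b = m∸n≢0⇒n<m (λ 1+b∸a≡0 → n≮0 (subst (d <_) 1+b∸a≡0 d<n))

length-map-range : ∀ {A : Set} (f : ℕ → A) a b → length (map f (range a b)) ≡ suc b ∸ a
length-map-range f a b = trans (length-map f (range a b)) (length-range a b)

module _ {d : ℕ} .{{_ : NonZero d}} where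

  [m%d+n]%d≡[m+n]%d : ∀ m n → (m % d + n) % d ≡ (m + n) % d
  [m%d+n]%d≡[m+n]%d m n = begin
    (m % d + n) % d         ≡⟨ %-distribˡ-+ (m % d) n d ⟩
    (m % d % d + n % d) % d ≡⟨ cong (λ x → (x + n % d) % d) (m%n%n≡m%n m d) ⟩
    (m % d + n % d) % d     ≡⟨ %-distribˡ-+ m n d ⟨
    (m + n) % d             ∎
    where open ≡-Reasoning

  [m+n%d]%d≡[m+n]%d : ∀ m n → (m + n % d) % d ≡ (m + n) % d
  [m+n%d]%d≡[m+n]%d m n = begin
    (m + n % d) % d ≡⟨ cong (_% d) (+-comm m (n % d)) ⟩
    (n % d + m) % d ≡⟨ [m%d+n]%d≡[m+n]%d n m ⟩
    (n + m) % d     ≡⟨ cong (_% d) (+-comm n m) ⟩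
    (m + n) % d     ∎
    where open ≡-Reasoning

  [m+[d∸n%d]+n]%d≡m%d : ∀ m n → (m + (d ∸ n % d) + n) % d ≡ m % d
  [m+[d∸n%d]+n]%d≡m%d m n = begin
    (m + (d ∸ n % d) + n) % d     ≡⟨ [m+n%d]%d≡[m+n]%d (m + (d ∸ n % d)) n ⟨
    (m + (d ∸ n % d) + n % d) % d ≡⟨ cong (_% d) (+-assoc m (d ∸ n % d) (n % d)) ⟩
    (m + (d ∸ n % d + n % d)) % d ≡⟨ cong (λ x → (m + x) % d) (m∸n+n≡m (m%n≤n n d)) ⟩
    (m + d) % d                   ≡⟨ [m+n]%n≡m%n m d ⟩
    m % d                         ∎
    where open ≡-Reasoning

  [m+n]%d≡o%d⇒[d∸m%d+o]%d≡n%d : ∀ {m n o} → (m + n) % d ≡ o % d → (d ∸ m % d + o) % d ≡ n % d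
  [m+n]%d≡o%d⇒[d∸m%d+o]%d≡n%d {m} {n} {o} eq = begin
    (d ∸ m % d + o) % d           ≡⟨ [m+n%d]%d≡[m+n]%d (d ∸ m % d) o ⟨
    (d ∸ m % d + o % d) % d       ≡⟨ cong (λ x → (d ∸ m % d + x) % d) eq ⟨
    (d ∸ m % d + (m + n) % d) % d ≡⟨ [m+n%d]%d≡[m+n]%d (d ∸ m % d) (m + n) ⟩
    (d ∸ m % d + (m + n)) % d     ≡⟨ cong (_% d) (x∙yz≈zx∙y (d ∸ m % d) m n) ⟩
    (n + (d ∸ m % d) + m) % d     ≡⟨ [m+[d∸n%d]+n]%d≡m%d n m ⟩
    n % d                         ∎
    where open ≡-Reasoning

module DihedralProperties (m : ℕ) .{{_ : NonZero m}} where
  open Dihedral m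

  Covers : List (Dih m) → Set
  Covers L = ∀ {g} → g ≢ e → g ∈ L

  toℕ-mod : ∀ a → toℕ (a mod m) ≡ a % m
  toℕ-mod a = toℕ-fromℕ< (m%n<n a m)

  mod-cong : ∀ {a b} → a % m ≡ b % m → a mod m ≡ b mod m
  mod-cong {a} {b} eq = toℕ-injective (trans (toℕ-mod a) (trans eq (sym (toℕ-mod b))))

  mod-toℕ : ∀ (t : Fin m) → toℕ t mod m ≡ t
  mod-toℕ t = toℕ-injective (trans (toℕ-mod (toℕ t)) (m<n⇒m%n≡m (toℕ<n t)))

  mod-injective : ∀ {a b} → a < m → b < m → a mod m ≡ b mod m → a ≡ b
  mod-injective {a} {b} a<m b<m eq = begin
    a             ≡⟨ m<n⇒m%n≡m a<m ⟨
    a % m         ≡⟨ toℕ-mod a ⟨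
    toℕ (a mod m) ≡⟨ cong toℕ eq ⟩
    toℕ (b mod m) ≡⟨ toℕ-mod b ⟩
    b % m         ≡⟨ m<n⇒m%n≡m b<m ⟩
    b             ∎
    where open ≡-Reasoning

  rotations-disjoint-reflections : ∀ {A B : Set} (f : A → Fin m) (g : B → Fin m) xs ys →
    Disjoint (map (λ x → Dih m ∋ (false , f x)) xs) (map (λ y → true , g y) ys)
  rotations-disjoint-reflections f g xs ys (p , q)
    with _ , _ , refl ← ∈-map⁻ (λ x → false , f x) p
    with _ , _ , () ← ∈-map⁻ (λ y → true , g y) q

  exponents-unique : ∀ (a : Bool) (f : ℕ → ℕ) c d → (∀ {i} → c ≤ i → i ≤ d → f i < m) →
                     (∀ {i j} → f i ≡ f j → i ≡ j) → Unique (map (λ i → a , f i mod m) (range c d))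
  exponents-unique a f c d f<m f-injective = map-injectiveOn⁺ (λ i → a , f i mod m)
    (λ i∈ j∈ eq → f-injective (mod-injective (bound i∈) (bound j∈) (cong proj₂ eq))) (range-unique c d)
    where
    bound : ∀ {i} → i ∈ range c d → f i < m
    bound i∈ = let c≤i , i≤d = ∈-range⁻ c d i∈ in f<m c≤i i≤d

  ·-inv-r^ : ∀ a i j t → (t + j) % m ≡ i % m → (a , i mod m) · inv (r^ j) ≡ (a , t mod m)
  ·-inv-r^ a i j t eq = cong₂ _,_ (xor-identityʳ a) (mod-cong (begin
    (toℕ (i mod m) + toℕ ((m ∸ toℕ (j mod m)) mod m)) % m
      ≡⟨ cong₂ (λ x y → (x + y) % m) (toℕ-mod i)
               (trans (toℕ-mod _) (cong (λ y → (m ∸ y) % m) (toℕ-mod j))) ⟩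
    (i % m + (m ∸ j % m) % m) % m   ≡⟨ [m+n%d]%d≡[m+n]%d (i % m) (m ∸ j % m) ⟩
    (i % m + (m ∸ j % m)) % m       ≡⟨ cong (λ x → (x + (m ∸ j % m)) % m) eq ⟨
    ((t + j) % m + (m ∸ j % m)) % m ≡⟨ [m%d+n]%d≡[m+n]%d (t + j) (m ∸ j % m) ⟩
    (t + j + (m ∸ j % m)) % m       ≡⟨ cong (_% m) (xy∙z≈xz∙y t j (m ∸ j % m)) ⟩
    (t + (m ∸ j % m) + j) % m       ≡⟨ [m+[d∸n%d]+n]%d≡m%d t j ⟩
    t % m                           ∎))
    where open ≡-Reasoning

  ·-inv-sr^ : ∀ a i j t → (t + i) % m ≡ j % m → (a , i mod m) · inv (sr^ j) ≡ (not a , t mod m)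
  ·-inv-sr^ a i j t eq = cong₂ _,_ (xor-comm a true) (mod-cong (begin
    (m ∸ toℕ (i mod m) + toℕ (j mod m)) % m
                                  ≡⟨ cong₂ (λ x y → (m ∸ x + y) % m) (toℕ-mod i) (toℕ-mod j) ⟩
    (m ∸ i % m + j % m) % m       ≡⟨ cong (λ x → (m ∸ i % m + x) % m) eq ⟨
    (m ∸ i % m + (t + i) % m) % m ≡⟨ [m+n%d]%d≡[m+n]%d (m ∸ i % m) (t + i) ⟩
    (m ∸ i % m + (t + i)) % m     ≡⟨ cong (_% m) (x∙yz≈yx∙z (m ∸ i % m) t i) ⟩
    (t + (m ∸ i % m) + i) % m     ≡⟨ [m+[d∸n%d]+n]%d≡m%d t i ⟩
    t % m                         ∎))
    where open ≡-Reasoning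

  inv-r^ : ∀ t → inv (r^ t) ≡ r^ (m ∸ t % m)
  inv-r^ t = cong (λ x → false , (m ∸ x) mod m) (toℕ-mod t)

  inv-e : inv e ≡ e
  inv-e = trans (inv-r^ 0) (cong (false ,_) (mod-cong (begin
    (m ∸ 0 % m) % m     ≡⟨ cong (_% m) (+-identityʳ _) ⟨
    (m ∸ 0 % m + 0) % m ≡⟨ [m+n]%d≡o%d⇒[d∸m%d+o]%d≡n%d refl ⟩
    0 % m               ∎)))
    where open ≡-Reasoning

  inv-involutive : ∀ g → inv (inv g) ≡ g
  inv-involutive (true  , t) = refl
  inv-involutive (false , t) = cong (false ,_) (trans (mod-cong (begin
    (m ∸ toℕ ((m ∸ toℕ t) mod m)) % m ≡⟨ cong (λ x → (m ∸ x) % m) (toℕ-mod (m ∸ toℕ t)) ⟩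
    (m ∸ (m ∸ toℕ t) % m) % m         ≡⟨ cong (_% m) (+-identityʳ _) ⟨
    (m ∸ (m ∸ toℕ t) % m + 0) % m     ≡⟨ [m+n]%d≡o%d⇒[d∸m%d+o]%d≡n%d [m-t+t]%m≡0%m ⟩
    toℕ t % m                         ∎)) (mod-toℕ t))
    where
    open ≡-Reasoning
    [m-t+t]%m≡0%m : (m ∸ toℕ t + toℕ t) % m ≡ 0 % m
    [m-t+t]%m≡0%m = begin
      (m ∸ toℕ t + toℕ t) % m ≡⟨ cong (_% m) (m∸n+n≡m (toℕ≤n t)) ⟩
      m % m                   ≡⟨ n%n≡0 m ⟩
      0                       ≡⟨ m<n⇒m%n≡m (>-nonZero⁻¹ m) ⟨
      0 % m                   ∎

  inv-·-inv : ∀ x y → inv (x · inv y) ≡ y · inv x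
  inv-·-inv (a , i) (b , j) =
    subst₂ (λ x y → inv (x · inv y) ≡ y · inv x) (cong (a ,_) (mod-toℕ i)) (cong (b ,_) (mod-toℕ j))
      (on-exponents a b (toℕ i) (toℕ j))
    where
    on-exponents : ∀ a b i j → inv ((a , i mod m) · inv (b , j mod m)) ≡ (b , j mod m) · inv (a , i mod m)
    on-exponents false false i j = begin
      inv (r^ i · inv (r^ j)) ≡⟨ cong inv (·-inv-r^ false i j t eq) ⟩
      inv (r^ t)              ≡⟨ inv-r^ t ⟩
      r^ (m ∸ t % m)          ≡⟨ ·-inv-r^ false j i (m ∸ t % m) ([m+n]%d≡o%d⇒[d∸m%d+o]%d≡n%d eq) ⟨
      r^ j · inv (r^ i)       ∎
      where
      open ≡-Reasoning
      t = i + (m ∸ j % m)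
      eq = [m+[d∸n%d]+n]%d≡m%d i j
    on-exponents true false i j = trans (cong inv (·-inv-r^ true i j t eq)) (sym (·-inv-sr^ false j i t eq))
      where
      t = i + (m ∸ j % m)
      eq = [m+[d∸n%d]+n]%d≡m%d i j
    on-exponents false true i j = trans (cong inv (·-inv-sr^ false i j t eq)) (sym (·-inv-r^ true j i t eq))
      where
      t = j + (m ∸ i % m)
      eq = [m+[d∸n%d]+n]%d≡m%d j i
    on-exponents true true i j = begin
      inv (sr^ i · inv (sr^ j)) ≡⟨ cong inv (·-inv-sr^ true i j t eq) ⟩
      inv (r^ t)                ≡⟨ inv-r^ t ⟩
      r^ (m ∸ t % m)            ≡⟨ ·-inv-sr^ true j i (m ∸ t % m) ([m+n]%d≡o%d⇒[d∸m%d+o]%d≡n%d eq) ⟨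
      sr^ j · inv (sr^ i)       ∎
      where
      open ≡-Reasoning
      t = j + (m ∸ i % m)
      eq = [m+[d∸n%d]+n]%d≡m%d j i

  quotients≡cartesianProductWith : ∀ X Y → quotients X Y ≡ cartesianProductWith (λ x y → x · inv y) X Y
  quotients≡cartesianProductWith []      Y = refl
  quotients≡cartesianProductWith (x ∷ X) Y =
    cong (map (λ y → x · inv y) Y ++_) (quotients≡cartesianProductWith X Y)

  ∈-quotients⁺ : ∀ {X Y x y g} → x ∈ X → y ∈ Y → x · inv y ≡ g → g ∈ quotients X Y
  ∈-quotients⁺ {X} {Y} x∈ y∈ refl =
    subst (_ ∈_) (sym (quotients≡cartesianProductWith X Y)) (∈-cartesianProductWith⁺ _ x∈ y∈)

  inv-∈-quotients : ∀ {X Y g} → g ∈ quotients X Y → inv g ∈ quotients Y X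
  inv-∈-quotients {X} {Y} g∈
    with x , y , x∈ , y∈ , refl ←
      ∈-cartesianProductWith⁻ _ X Y (subst (_ ∈_) (quotients≡cartesianProductWith X Y) g∈)
    = ∈-quotients⁺ y∈ x∈ (sym (inv-·-inv x y))

  length-quotients : ∀ X Y → length (quotients X Y) ≡ length X * length Y
  length-quotients []      Y = refl
  length-quotients (x ∷ X) Y = begin
    length (map (λ y → x · inv y) Y ++ quotients X Y)
      ≡⟨ length-++ (map (λ y → x · inv y) Y) ⟩
    length (map (λ y → x · inv y) Y) + length (quotients X Y)
      ≡⟨ cong₂ _+_ (length-map _ Y) (length-quotients X Y) ⟩
    length Y + length X * length Y
      ∎
    where open ≡-Reasoning

  covers-swap : ∀ X Y → Covers (quotients X Y) → Covers (quotients Y X)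
  covers-swap X Y cover {g} g≢e =
    subst (_∈ quotients Y X) (inv-involutive g) (inv-∈-quotients {X} {Y} (cover inv-g≢e))
    where
    inv-g≢e : inv g ≢ e
    inv-g≢e inv-g≡e = g≢e (trans (sym (inv-involutive g)) (trans (cong inv inv-g≡e) inv-e))

module NonIdentity (n : ℕ) where
  open Dihedral (suc n)
  open DihedralProperties (suc n)
  open Counting _≟D_

  nonIdentity : List (Dih (suc n))
  nonIdentity = map (λ t → false , fsuc t) (allFin n) ++ map (true ,_) (allFin (suc n))

  nonIdentity-unique : Unique nonIdentity
  nonIdentity-unique = Unique.++⁺
    (Unique.map⁺ (λ eq → fsuc-injective (cong proj₂ eq)) (Unique.allFin⁺ n))
    (Unique.map⁺ (cong proj₂) (Unique.allFin⁺ (suc n)))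
    (rotations-disjoint-reflections fsuc (λ t → t) (allFin n) (allFin (suc n)))

  ∈-nonIdentity⁺ : ∀ {g} → g ≢ e → g ∈ nonIdentity
  ∈-nonIdentity⁺ {false , fzero}  g≢e = contradiction refl g≢e
  ∈-nonIdentity⁺ {false , fsuc t} _   = ∈-++⁺ˡ (∈-map⁺ _ (∈-allFin t))
  ∈-nonIdentity⁺ {true  , t}      _   = ∈-++⁺ʳ _ (∈-map⁺ _ (∈-allFin t))

  ∈-nonIdentity⁻ : ∀ {g} → g ∈ nonIdentity → g ≢ e
  ∈-nonIdentity⁻ g∈ with ∈-++⁻ (map (λ t → false , fsuc t) (allFin n)) g∈
  ... | inj₁ p with _ , _ , refl ← ∈-map⁻ _ p = λ ()
  ... | inj₂ p with _ , _ , refl ← ∈-map⁻ _ p = λ ()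

  length-nonIdentity : length nonIdentity ≡ n + suc n
  length-nonIdentity = trans (length-++ (map (λ t → false , fsuc t) (allFin n)))
    (cong₂ _+_ (length-map-allFin n (λ t → false , fsuc t)) (length-map-allFin (suc n) (true ,_)))
    where
    length-map-allFin : ∀ k (f : Fin k → Dih (suc n)) → length (map f (allFin k)) ≡ k
    length-map-allFin k f = trans (length-map f (allFin k)) (length-tabulate {n = k} (λ t → t))

  covers⇒mult≡1 : ∀ {L} → length L ≤ n + suc n → Covers L → ∀ {g} → g ≢ e → mult g L ≡ 1
  covers⇒mult≡1 len cover g≢e =
    cover⇒count≡1 nonIdentity-unique (≤-trans len (≤-reflexive (sym length-nonIdentity)))
      (cover ∘ ∈-nonIdentity⁻) (∈-nonIdentity⁺ g≢e)

  covering-pair⇒IsSEDF : ∀ {k} (A : Fin 2 → List (Dih (suc n))) → k * k + 1 ≡ 2 * suc n →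
    (∀ i → Unique (A i) × length (A i) ≡ k) → (∀ x → x ∈ A fzero → x ∉ A (fsuc fzero)) →
    Covers (quotients (A fzero) (A (fsuc fzero))) → IsSEDF 2 k 1 A
  covering-pair⇒IsSEDF {k} A k²+1≡2m uniqueLength disjoint cover =
    s≤s (s≤s z≤n) , uniqueLength , distinct , λ
      { fzero        → balanced (A fzero) (A (fsuc fzero)) (|A| fzero) (|A| (fsuc fzero)) cover
      ; (fsuc fzero) → balanced (A (fsuc fzero)) (A fzero) (|A| (fsuc fzero)) (|A| fzero)
                                (covers-swap (A fzero) (A (fsuc fzero)) cover) }
    where
    k²≡n+[1+n] : k * k ≡ n + suc n
    k²≡n+[1+n] = +-cancelʳ-≡ 1 (k * k) (n + suc n) (trans k²+1≡2m (double n))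
      where
      double : ∀ n → 2 * suc n ≡ n + suc n + 1
      double = solve-∀
    |A| : ∀ i → length (A i) ≡ k
    |A| i = proj₂ (uniqueLength i)
    distinct : ∀ i j → i ≢ j → ∀ x → x ∈ A i → x ∉ A j
    distinct fzero        fzero        i≢j = contradiction refl i≢j
    distinct fzero        (fsuc fzero) _   = disjoint
    distinct (fsuc fzero) fzero        _   = λ x x∈A₁ x∈A₀ → disjoint x x∈A₀ x∈A₁
    distinct (fsuc fzero) (fsuc fzero) i≢j = contradiction refl i≢j
    balanced : ∀ X Y → length X ≡ k → length Y ≡ k → Covers (quotients X Y) →
               ∀ g → g ≢ e → mult g (quotients X (Y ++ [])) ≡ 1
    balanced X Y |X| |Y| cover g g≢e = subst (λ Z → mult g (quotients X Z) ≡ 1) (sym (++-identityʳ Y))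
      (covers⇒mult≡1 (≤-reflexive (trans (length-quotients X Y) (trans (cong₂ _*_ |X| |Y|) k²≡n+[1+n])))
        cover g≢e)

odd⇒≡3+2h : ∀ {k} → 1 < k → k % 2 ≡ 1 → ∃ λ h₀ → k ≡ suc (suc h₀ + suc h₀)
odd⇒≡3+2h {k} 1<k k%2≡1 with k / 2 | trans (m≡m%n+[m/n]*n k 2) (cong (_+ (k / 2) * 2) k%2≡1)
... | zero   | k≡1    = contradiction k≡1 (>⇒≢ 1<k)
... | suc h₀ | k≡1+2h = h₀ , trans k≡1+2h (twice+1 h₀)
  where
  twice+1 : ∀ h₀ → 1 + suc h₀ * 2 ≡ suc (suc h₀ + suc h₀)
  twice+1 = solve-∀

odd-square : ∀ h → suc (h + h) * suc (h + h) + 1 ≡ 2 * suc (h + h * suc (h + h))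
odd-square = solve-∀

half-double : ∀ x → (x + x) / 2 ≡ x
half-double x = trans (cong (_/ 2) (double x)) (m*n/n≡m x 2)
  where
  double : ∀ x → x + x ≡ x * 2
  double = solve-∀

-- h ≥ 1: for k = 1 the truncated (k ∸ 3) / 2 in the definition of A₁ would be 0, not −1.
module Construction (h₀ : ℕ) where
  h k n m : ℕ
  h = suc h₀
  k = suc (h + h)
  n = h + h * k
  m = suc n

  open Dihedral m
  open DihedralProperties m
  open Thm62Sets k m using (A₁; A₂; family)

  k*k+1≡2*m : k * k + 1 ≡ 2 * m
  k*k+1≡2*m = odd-square h

  h<k : h < k
  h<k = s≤s (m≤m+n h h)

  h<m : h < m
  h<m = s≤s (m≤m+n h (h * k))

  ≤h⇒*k<m : ∀ {j} → j ≤ h → j * k < m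
  ≤h⇒*k<m j≤h = s≤s (≤-trans (*-monoˡ-≤ k j≤h) (m≤n+m (h * k) h))

  ≤h⇒*k+h<m : ∀ {q} → q ≤ h → q * k + h < m
  ≤h⇒*k+h<m q≤h = s≤s (≤-trans (+-monoˡ-≤ h (*-monoˡ-≤ k q≤h)) (≤-reflexive (+-comm (h * k) h)))

  c+q*k<m⇒q≤h : ∀ c q → c + q * k < m → q ≤ h
  c+q*k<m⇒q≤h c q lt = s≤s⁻¹ (*-cancelʳ-< k q (suc h) (begin-strict
    q * k           ≤⟨ m≤n+m (q * k) c ⟩
    c + q * k       <⟨ lt ⟩
    suc (h + h * k) ≤⟨ s≤s (+-monoˡ-≤ (h * k) (m≤m+n h h)) ⟩
    suc h * k       ∎))
    where open ≤-Reasoning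

  1+h+i+q*k<m⇒q<h : ∀ i q → suc (h + i + q * k) < m → q < h
  1+h+i+q*k<m⇒q<h i q lt = *-cancelʳ-< k q h (+-cancelˡ-< h (q * k) (h * k) (begin-strict
    h + q * k     ≤⟨ +-monoˡ-≤ (q * k) (m≤m+n h i) ⟩
    h + i + q * k <⟨ s≤s⁻¹ lt ⟩
    h + h * k     ∎))
    where open ≤-Reasoning

  1+q+j≡h⇒1+j≤h : ∀ q j → suc q + j ≡ h → suc j ≤ h
  1+q+j≡h⇒1+j≤h q j 1+q+j≡h = m+n≤o⇒n≤o q (≤-reflexive (trans (+-suc q j) 1+q+j≡h))

  c+q*k+i≡q*k+h : ∀ c q i → c + i ≡ h → c + q * k + i ≡ q * k + h
  c+q*k+i≡q*k+h c q i c+i≡h = trans (xy∙z≈y∙xz c (q * k) i) (cong (q * k +_) c+i≡h)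

  [1+h+i+q*k+[1+j]*k]%m≡i%m : ∀ i q j → suc q + j ≡ h → (suc (h + i + q * k) + suc j * k) % m ≡ i % m
  [1+h+i+q*k+[1+j]*k]%m≡i%m i q j 1+q+j≡h = begin
    (suc (h + i + q * k) + suc j * k) % m ≡⟨ cong (_% m) (rearrange h i q j k) ⟩
    (i + suc (h + (suc q + j) * k)) % m   ≡⟨ cong (λ x → (i + suc (h + x * k)) % m) 1+q+j≡h ⟩
    (i + m) % m                           ≡⟨ [m+n]%n≡m%n i m ⟩
    i % m                                 ∎
    where
    open ≡-Reasoning
    rearrange : ∀ h i q j k → suc (h + i + q * k) + suc j * k ≡ i + suc (h + (suc q + j) * k)
    rearrange = solve-∀

  A₁′ A₂′ : List (Dih m)
  A₁′ = map r^ (range 0 h) ++ map sr^ (range 0 h₀)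
  A₂′ = map (λ j → r^ (j * k)) (range 1 h) ++ map (λ q → sr^ (q * k + h)) (range 0 h)

  A₁≡A₁′ : A₁ ≡ A₁′
  A₁≡A₁′ = cong₂ (λ a b → map r^ (range 0 a) ++ map sr^ (range 0 b)) (half-double h)
    (trans (cong (λ x → (x ∸ 1) / 2) (+-suc h₀ h₀)) (half-double h₀))

  A₂≡A₂′ : A₂ ≡ A₂′
  A₂≡A₂′ = cong (λ a → map (λ j → r^ (j * k)) (range 1 a) ++ map (λ q → sr^ (q * k + a)) (range 0 a))
    (half-double h)

  r^∈A₁′ : ∀ {i} → i ≤ h → r^ i ∈ A₁′
  r^∈A₁′ i≤h = ∈-++⁺ˡ (∈-map⁺ r^ (∈-range⁺ 0 i≤h))

  sr^∈A₁′ : ∀ {i} → i < h → sr^ i ∈ A₁′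
  sr^∈A₁′ i<h = ∈-++⁺ʳ (map r^ (range 0 h)) (∈-map⁺ sr^ (∈-range⁺ 0 (s≤s⁻¹ i<h)))

  r^∈A₂′ : ∀ j → suc j ≤ h → r^ (suc j * k) ∈ A₂′
  r^∈A₂′ j 1+j≤h = ∈-++⁺ˡ (∈-map⁺ (λ j → r^ (j * k)) (∈-range⁺ 1 1+j≤h))

  sr^∈A₂′ : ∀ q → q ≤ h → sr^ (q * k + h) ∈ A₂′
  sr^∈A₂′ q q≤h =
    ∈-++⁺ʳ (map (λ j → r^ (j * k)) (range 1 h)) (∈-map⁺ (λ q → sr^ (q * k + h)) (∈-range⁺ 0 q≤h))

  A₁′-unique : Unique A₁′
  A₁′-unique = Unique.++⁺
    (exponents-unique false (λ i → i) 0 h  (λ _ i≤h → ≤-<-trans i≤h h<m) (λ eq → eq))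
    (exponents-unique true  (λ i → i) 0 h₀ (λ _ i≤h₀ → <-trans (s≤s i≤h₀) h<m) (λ eq → eq))
    (rotations-disjoint-reflections (_mod m) (_mod m) (range 0 h) (range 0 h₀))

  A₂′-unique : Unique A₂′
  A₂′-unique = Unique.++⁺
    (exponents-unique false (_* k) 1 h (λ _ → ≤h⇒*k<m) (*-cancelʳ-≡ _ _ k))
    (exponents-unique true (λ q → q * k + h) 0 h (λ _ → ≤h⇒*k+h<m)
      (*-cancelʳ-≡ _ _ k ∘ +-cancelʳ-≡ h _ _))
    (rotations-disjoint-reflections (λ j → (j * k) mod m) (λ q → (q * k + h) mod m) (range 1 h) (range 0 h))

  length-A₁′ : length A₁′ ≡ k
  length-A₁′ = trans (length-++ (map r^ (range 0 h)))
    (cong₂ _+_ (length-map-range r^ 0 h) (length-map-range sr^ 0 h₀))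

  length-A₂′ : length A₂′ ≡ k
  length-A₂′ = trans (length-++ (map (λ j → r^ (j * k)) (range 1 h)))
    (trans (cong₂ _+_ (length-map-range _ 1 h) (length-map-range _ 0 h)) (+-suc h h))

  data A₁′-element (x : Dih m) : Set where
    rotation   : ∀ {i} → i ≤ h → x ≡ r^ i → A₁′-element x
    reflection : ∀ {i} → i < h → x ≡ sr^ i → A₁′-element x

  ∈A₁′⁻ : ∀ {x} → x ∈ A₁′ → A₁′-element x
  ∈A₁′⁻ x∈ with ∈-++⁻ (map r^ (range 0 h)) x∈
  ... | inj₁ p with _ , i∈ , x≡ ← ∈-map⁻ r^ p  = rotation (proj₂ (∈-range⁻ 0 h i∈)) x≡
  ... | inj₂ p with _ , i∈ , x≡ ← ∈-map⁻ sr^ p = reflection (s≤s (proj₂ (∈-range⁻ 0 h₀ i∈))) x≡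

  data A₂′-element (x : Dih m) : Set where
    rotation   : ∀ {j} → 1 ≤ j → j ≤ h → x ≡ r^ (j * k) → A₂′-element x
    reflection : ∀ {q} → q ≤ h → x ≡ sr^ (q * k + h) → A₂′-element x

  ∈A₂′⁻ : ∀ {x} → x ∈ A₂′ → A₂′-element x
  ∈A₂′⁻ x∈ with ∈-++⁻ (map (λ j → r^ (j * k)) (range 1 h)) x∈
  ... | inj₁ p with _ , j∈ , x≡ ← ∈-map⁻ (λ j → r^ (j * k)) p =
    let 1≤j , j≤h = ∈-range⁻ 1 h j∈ in rotation 1≤j j≤h x≡
  ... | inj₂ p with _ , q∈ , x≡ ← ∈-map⁻ (λ q → sr^ (q * k + h)) p =
    reflection (proj₂ (∈-range⁻ 0 h q∈)) x≡

  A₁′-disjoint-A₂′ : ∀ x → x ∈ A₁′ → x ∉ A₂′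
  A₁′-disjoint-A₂′ x x∈A₁′ x∈A₂′ with ∈A₁′⁻ x∈A₁′ | ∈A₂′⁻ x∈A₂′
  ... | rotation {i} i≤h refl | rotation {j} 1≤j j≤h eq =
    <-irrefl (mod-injective (≤-<-trans i≤h h<m) (≤h⇒*k<m j≤h) (cong proj₂ eq))
      (<-≤-trans (≤-<-trans i≤h h<k) (≤-trans (≤-reflexive (sym (*-identityˡ k))) (*-monoˡ-≤ k 1≤j)))
  ... | rotation _ refl   | reflection _ eq   = contradiction (cong proj₁ eq) λ ()
  ... | reflection _ refl | rotation _ _ eq   = contradiction (cong proj₁ eq) λ ()
  ... | reflection {i} i<h refl | reflection {q} q≤h eq =
    <-irrefl (mod-injective (<-trans i<h h<m) (≤h⇒*k+h<m q≤h) (cong proj₂ eq))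
      (<-≤-trans i<h (m≤n+m h (q * k)))

  divide-by-k : ∀ t → ∃₂ λ c q → t ≡ c + q * k × c < k
  divide-by-k t = t % k , t / k , m≡m%n+[m/n]*n t k , m%n<n t k

  r^∈A₁′A₂′⁻¹ : ∀ t → suc t < m → r^ (suc t) ∈ quotients A₁′ A₂′
  r^∈A₁′A₂′⁻¹ t 1+t<m with c , q , refl , c<k ← divide-by-k t with c <? h
  ... | yes c<h with i , 1+c+i≡h ← m≤n⇒∃[o]m+o≡n c<h =
    ∈-quotients⁺ (sr^∈A₁′ i<h) (sr^∈A₂′ q (c+q*k<m⇒q≤h (suc c) q 1+t<m))
      (·-inv-sr^ true i (q * k + h) (suc (c + q * k)) (cong (_% m) (c+q*k+i≡q*k+h (suc c) q i 1+c+i≡h)))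
    where
    i<h : i < h
    i<h = m+n≤o⇒n≤o c (≤-reflexive (trans (+-suc c i) 1+c+i≡h))
  ... | no c≮h with i , refl ← m≤n⇒∃[o]m+o≡n (≮⇒≥ c≮h)
               with j , 1+q+j≡h ← m≤n⇒∃[o]m+o≡n (1+h+i+q*k<m⇒q<h i q 1+t<m) =
    ∈-quotients⁺ (r^∈A₁′ (+-cancelˡ-≤ h i h (s≤s⁻¹ c<k))) (r^∈A₂′ j (1+q+j≡h⇒1+j≤h q j 1+q+j≡h))
      (·-inv-r^ false i (suc j * k) (suc (h + i + q * k)) ([1+h+i+q*k+[1+j]*k]%m≡i%m i q j 1+q+j≡h))

  sr^∈A₁′A₂′⁻¹ : ∀ t → t < m → sr^ t ∈ quotients A₁′ A₂′
  sr^∈A₁′A₂′⁻¹ t t<m with c , q , refl , c<k ← divide-by-k t with c ≤? h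
  ... | yes c≤h with i , c+i≡h ← m≤n⇒∃[o]m+o≡n c≤h =
    ∈-quotients⁺ (r^∈A₁′ (m+n≤o⇒n≤o c (≤-reflexive c+i≡h))) (sr^∈A₂′ q (c+q*k<m⇒q≤h c q t<m))
      (·-inv-sr^ false i (q * k + h) (c + q * k) (cong (_% m) (c+q*k+i≡q*k+h c q i c+i≡h)))
  ... | no c≰h with i , refl ← m≤n⇒∃[o]m+o≡n (≰⇒> c≰h)
               with j , 1+q+j≡h ← m≤n⇒∃[o]m+o≡n (1+h+i+q*k<m⇒q<h i q t<m) =
    ∈-quotients⁺ (sr^∈A₁′ (+-cancelˡ-< h i h (s≤s⁻¹ c<k))) (r^∈A₂′ j (1+q+j≡h⇒1+j≤h q j 1+q+j≡h))
      (·-inv-r^ true i (suc j * k) (suc (h + i + q * k)) ([1+h+i+q*k+[1+j]*k]%m≡i%m i q j 1+q+j≡h))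

  A₁′A₂′⁻¹-covers : Covers (quotients A₁′ A₂′)
  A₁′A₂′⁻¹-covers {false , fzero}  g≢e = contradiction refl g≢e
  A₁′A₂′⁻¹-covers {false , fsuc t} _   = subst (_∈ quotients A₁′ A₂′) (cong (false ,_) (mod-toℕ (fsuc t)))
    (r^∈A₁′A₂′⁻¹ (toℕ t) (toℕ<n (fsuc t)))
  A₁′A₂′⁻¹-covers {true , t}       _   = subst (_∈ quotients A₁′ A₂′) (cong (true ,_) (mod-toℕ t))
    (sr^∈A₁′A₂′⁻¹ (toℕ t) (toℕ<n t))

  family-isSEDF : IsSEDF 2 k 1 family
  family-isSEDF = NonIdentity.covering-pair⇒IsSEDF n family k*k+1≡2*m uniqueLength disjoint covers
    where
    UniqueOfLength-k : List (Dih m) → Set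
    UniqueOfLength-k X = Unique X × length X ≡ k
    uniqueLength : ∀ i → UniqueOfLength-k (family i)
    uniqueLength fzero    = subst UniqueOfLength-k (sym A₁≡A₁′) (A₁′-unique , length-A₁′)
    uniqueLength (fsuc _) = subst UniqueOfLength-k (sym A₂≡A₂′) (A₂′-unique , length-A₂′)
    disjoint : ∀ x → x ∈ A₁ → x ∉ A₂
    disjoint = subst₂ (λ X Y → ∀ x → x ∈ X → x ∉ Y) (sym A₁≡A₁′) (sym A₂≡A₂′) A₁′-disjoint-A₂′
    covers : Covers (quotients A₁ A₂)
    covers = subst₂ (λ X Y → Covers (quotients X Y)) (sym A₁≡A₁′) (sym A₂≡A₂′) A₁′A₂′⁻¹-covers

theorem6p2 : (k m : ℕ) → 1 < k → k % 2 ≡ 1 → k * k + 1 ≡ 2 * m → {{_ : NonZero m}} →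
    Dihedral.IsSEDF m 2 k 1 (Thm62Sets.family k m)
      × Σ (Fin 2 → List (Dih m)) (λ A → Dihedral.IsSEDF m 2 k 1 A)
theorem6p2 k m 1<k k-odd k²+1≡2m with h₀ , refl ← odd⇒≡3+2h 1<k k-odd
  with refl ← *-cancelˡ-≡ m (Construction.m h₀) 2 (trans (sym k²+1≡2m) (Construction.k*k+1≡2*m h₀)) =
  family-isSEDF , _ , family-isSEDF
  where open Construction h₀
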